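{- Let $k\geq1$ and let $\phi$ be a quantified boolean combination of test formulae (with all numeric parameters $n\in\mathbb{N}$). Then $\phi$ has a finite $\mathsf{SL}$ model iff the first-order formula $T(\phi)$ has a finite first-order model.
   Context: An $\mathsf{SL}$-structure is $(U,s,h)$ with $U$ a countable set, $s:\mathsf{Var}\rightharpoonup U$ a store, $h:U\rightharpoonup U^k$ a partial map with finite domain; it is finite iff $U$ is finite. Test formulae and their semantics: $x\approx y$ ($s(x)=s(y)$); $x\hookrightarrow(y_1,\dots,y_k)$ ($s(x)\in\mathrm{dom}(h)$ and $h(s(x))=(s(y_1),\dots,s(y_k))$); $\mathsf{alloc}(x)$ ($s(x)\in\mathrm{dom}(h)$); $|h|\geq n$ ($|\mathrm{dom}(h)|\geq n$); $|U|\geq n$ ($|U|\geq n$); $|h|\geq|U|-n$ ($|U\setminus\mathrm{dom}(h)|\leq n$). A quantified boolean combination of test formulae is built from test formulae with $\neg,\wedge,\vee,\rightarrow,\leftrightarrow,\exists,\forall$ (quantifiers range over $U$). First-order structures are $(U,s,i)$ with universe $U$, store $s$ and interpretation $i$ of the function symbols. Let $\mathfrak{d}$ be a unary predicate symbol and $\mathfrak{f}_1,\dots,\mathfrak{f}_k$ unary function symbols; $\mathsf{distinct}(x_1,\dots,x_n)$ denotes $\bigwedge_{i=1}^n\bigwedge_{j=1}^{i-1}\neg x_i\approx x_j$. The translation $T$ is: $T(x\approx y)=x\approx y$; $T(x\hookrightarrow(y_1,\dots,y_k))=\mathfrak{d}(x)\wedge\bigwedge_{i=1}^k y_i\approx\mathfrak{f}_i(x)$;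 $T(\mathsf{alloc}(x))=\mathfrak{d}(x)$; $T$ commutes with $\neg$, binary boolean connectives and quantifiers; $T(|U|\geq n)=\exists x_1,\dots,x_n.\mathsf{distinct}(x_1,\dots,x_n)$; $T(|h|\geq n)=\exists x_1,\dots,x_n.\ \mathsf{distinct}(x_1,\dots,x_n)\wedge\bigwedge_{i=1}^n\mathfrak{d}(x_i)$; $T(|h|\geq|U|-n)=\exists x_1,\dots,x_n\forall y.\ \bigwedge_{i=1}^n y\not\approx x_i\rightarrow\mathfrak{d}(y)$. -}

module Defs where

open import Data.Nat using (ℕ; zero; suc; _≤_; _∸_)
open import Data.Fin using (Fin; zero; suc)
open import Data.Vec using (Vec; []; _∷_; lookup)
open import Data.Maybe using (Maybe; just; nothing)
open import Data.Bool using (Bool; true; false; T)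
open import Data.Product using (Σ; _×_; ∃-syntax)
open import Data.Sum using (_⊎_)
open import Data.Unit using (⊤)
open import Data.Empty using (⊥)
open import Relation.Nullary using (¬_)
open import Relation.Binary.PropositionalEquality using (_≡_)
open import Function.Bundles using (_⇔_)

-- Variables are de Bruijn indices: index 0 is the innermost bound variable,
-- indices beyond the binders refer to the (free) store variables.
Var : Set
Var = ℕ

data SLForm (k : ℕ) : Set where
  _≈ˢ_      : Var → Var → SLForm k
  _↪_       : Var → Vec Var k → SLForm k
  alloc     : Var → SLForm k
  |h|≥_     : ℕ → SLForm k
  |U|≥_     : ℕ → SLForm k
  |h|≥|U|-_ : ℕ → SLForm k
  ¬ˢ_       : SLForm k → SLForm k
  _∧ˢ_ _∨ˢ_ _⇒ˢ_ _⇔ˢ_ : SLForm k → SLForm k → SLForm k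
  ∃ˢ ∀ˢ     : SLForm k → SLForm k

Store : ℕ → Set
Store m = Var → Fin m

_∷ₛ_ : ∀ {m} → Fin m → Store m → Store m
(u ∷ₛ s) zero    = u
(u ∷ₛ s) (suc x) = s x

-- A finite SL-structure with universe Fin m: a store and a heap
-- h : U ⇀ U^k (finite domain automatically since U is finite).
record SLStruct (k m : ℕ) : Set where
  field
    store : Store m
    heap  : Fin m → Maybe (Vec (Fin m) k)

domSize : ∀ {m} {A : Set} → (Fin m → Maybe A) → ℕ
domSize {zero}  h = zero
domSize {suc m} h with h zero
... | just _  = suc (domSize (λ i → h (suc i)))
... | nothing = domSize (λ i → h (suc i))

⟦_⟧ˢ : ∀ {k m} → SLForm k → Store m → (Fin m → Maybe (Vec (Fin m) k)) → Set
⟦ x ≈ˢ y ⟧ˢ s h = s x ≡ s y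
⟦ x ↪ ys ⟧ˢ s h = h (s x) ≡ just (Data.Vec.map s ys)
⟦ alloc x ⟧ˢ s h = Σ _ λ v → h (s x) ≡ just v
⟦_⟧ˢ (|h|≥ n) s h = n ≤ domSize h
⟦_⟧ˢ {m = m} (|U|≥ n) s h = n ≤ m
⟦_⟧ˢ {m = m} (|h|≥|U|- n) s h = m ∸ domSize h ≤ n
⟦ ¬ˢ φ ⟧ˢ s h = ¬ ⟦ φ ⟧ˢ s h
⟦ φ ∧ˢ ψ ⟧ˢ s h = ⟦ φ ⟧ˢ s h × ⟦ ψ ⟧ˢ s h
⟦ φ ∨ˢ ψ ⟧ˢ s h = ⟦ φ ⟧ˢ s h ⊎ ⟦ ψ ⟧ˢ s h
⟦ φ ⇒ˢ ψ ⟧ˢ s h = ⟦ φ ⟧ˢ s h → ⟦ ψ ⟧ˢ s h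
⟦ φ ⇔ˢ ψ ⟧ˢ s h = ⟦ φ ⟧ˢ s h ⇔ ⟦ ψ ⟧ˢ s h
⟦ ∃ˢ φ ⟧ˢ s h = ∃[ u ] ⟦ φ ⟧ˢ (u ∷ₛ s) h
⟦ ∀ˢ φ ⟧ˢ s h = ∀ u → ⟦ φ ⟧ˢ (u ∷ₛ s) h

_⊨ˢ_ : ∀ {k m} → SLStruct k m → SLForm k → Set
M ⊨ˢ φ = ⟦ φ ⟧ˢ (SLStruct.store M) (SLStruct.heap M)

data Term (k : ℕ) : Set where
  var : Var → Term k
  𝔣   : Fin k → Term k → Term k

data FOForm (k : ℕ) : Set where
  ⊤ᶠ       : FOForm k
  _≈ᶠ_     : Term k → Term k → FOForm k
  𝔡        : Term k → FOForm k
  ¬ᶠ_      : FOForm k → FOForm k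
  _∧ᶠ_ _∨ᶠ_ _⇒ᶠ_ _⇔ᶠ_ : FOForm k → FOForm k → FOForm k
  ∃ᶠ ∀ᶠ    : FOForm k → FOForm k

record FOStruct (k m : ℕ) : Set where
  field
    store : Store m
    dI    : Fin m → Bool
    fI    : Fin k → Fin m → Fin m

evalT : ∀ {k m} → (Fin k → Fin m → Fin m) → Store m → Term k → Fin m
evalT f s (var x) = s x
evalT f s (𝔣 i t) = f i (evalT f s t)

⟦_⟧ᶠ : ∀ {k m} → FOForm k → (Fin m → Bool) → (Fin k → Fin m → Fin m) → Store m → Set
⟦ ⊤ᶠ ⟧ᶠ d f s = ⊤
⟦ t ≈ᶠ u ⟧ᶠ d f s = evalT f s t ≡ evalT f s u
⟦ 𝔡 t ⟧ᶠ d f s = T (d (evalT f s t))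
⟦ ¬ᶠ φ ⟧ᶠ d f s = ¬ ⟦ φ ⟧ᶠ d f s
⟦ φ ∧ᶠ ψ ⟧ᶠ d f s = ⟦ φ ⟧ᶠ d f s × ⟦ ψ ⟧ᶠ d f s
⟦ φ ∨ᶠ ψ ⟧ᶠ d f s = ⟦ φ ⟧ᶠ d f s ⊎ ⟦ ψ ⟧ᶠ d f s
⟦ φ ⇒ᶠ ψ ⟧ᶠ d f s = ⟦ φ ⟧ᶠ d f s → ⟦ ψ ⟧ᶠ d f s
⟦ φ ⇔ᶠ ψ ⟧ᶠ d f s = ⟦ φ ⟧ᶠ d f s ⇔ ⟦ ψ ⟧ᶠ d f s
⟦ ∃ᶠ φ ⟧ᶠ d f s = ∃[ u ] ⟦ φ ⟧ᶠ d f (u ∷ₛ s)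
⟦ ∀ᶠ φ ⟧ᶠ d f s = ∀ u → ⟦ φ ⟧ᶠ d f (u ∷ₛ s)

_⊨ᶠ_ : ∀ {k m} → FOStruct k m → FOForm k → Set
M ⊨ᶠ φ = ⟦ φ ⟧ᶠ (FOStruct.dI M) (FOStruct.fI M) (FOStruct.store M)

⋀ : ∀ {k} → ℕ → (ℕ → FOForm k) → FOForm k
⋀ zero    F = ⊤ᶠ
⋀ (suc n) F = ⋀ n F ∧ᶠ F n

∃ⁿ : ∀ {k} → ℕ → FOForm k → FOForm k
∃ⁿ zero    φ = φ
∃ⁿ (suc n) φ = ∃ᶠ (∃ⁿ n φ)

distinct : ∀ {k} → ℕ → FOForm k
distinct n = ⋀ n (λ i → ⋀ i (λ j → ¬ᶠ (var i ≈ᶠ var j)))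

⋀ᶠ : ∀ {k} (j : ℕ) → (Fin j → FOForm k) → FOForm k
⋀ᶠ zero    F = ⊤ᶠ
⋀ᶠ (suc j) F = F zero ∧ᶠ ⋀ᶠ j (λ i → F (suc i))

Tr : ∀ {k} → SLForm k → FOForm k
Tr (x ≈ˢ y) = var x ≈ᶠ var y
Tr (x ↪ ys) = 𝔡 (var x) ∧ᶠ ⋀ᶠ _ (λ i → var (lookup ys i) ≈ᶠ 𝔣 i (var x))
Tr (alloc x) = 𝔡 (var x)
Tr (|h|≥ n) = ∃ⁿ n (distinct n ∧ᶠ ⋀ n (λ i → 𝔡 (var i)))
Tr (|U|≥ n) = ∃ⁿ n (distinct n)
-- ∃x_1..x_n ∀y. (⋀ y ≉ x_i) → 𝔡(y): under the ∀, y is index 0 and x_i is index suc i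
Tr (|h|≥|U|- n) = ∃ⁿ n (∀ᶠ (⋀ n (λ i → ¬ᶠ (var 0 ≈ᶠ var (suc i))) ⇒ᶠ 𝔡 (var 0)))
Tr (¬ˢ φ) = ¬ᶠ Tr φ
Tr (φ ∧ˢ ψ) = Tr φ ∧ᶠ Tr ψ
Tr (φ ∨ˢ ψ) = Tr φ ∨ᶠ Tr ψ
Tr (φ ⇒ˢ ψ) = Tr φ ⇒ᶠ Tr ψ
Tr (φ ⇔ˢ ψ) = Tr φ ⇔ᶠ Tr ψ
Tr (∃ˢ φ) = ∃ᶠ (Tr φ)
Tr (∀ˢ φ) = ∀ᶠ (Tr φ)

HasFiniteSLModel : ∀ {k} → SLForm k → Set
HasFiniteSLModel {k} φ = ∃[ m ] Σ (SLStruct k m) λ M → M ⊨ˢ φ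

HasFiniteFOModel : ∀ {k} → FOForm k → Set
HasFiniteFOModel {k} ψ = ∃[ m ] Σ (FOStruct k m) λ M → M ⊨ᶠ ψ

module Submission where

open import Defs
open import Data.Nat using (ℕ; _≤_)
open import Function.Bundles using (_⇔_)

open import Data.Nat using (zero; suc; _<_; _+_; _∸_; z≤n; s≤s)
open import Data.Nat.Properties
  using (m<1+n⇒m<n∨m≡n; m<n⇒m<1+n; n<1+n; <⇒≢; <-trans; <-≤-trans; +-suc; +-identityʳ; m+n∸m≡n)
open import Data.Fin using (Fin; zero; suc) renaming (_≟_ to _≟ᶠ_)
open import Data.Vec using (Vec; []; _∷_; lookup; tabulate)
import Data.Vec as Vec
open import Data.Vec.Properties using (tabulate∘lookup; ∷-injective)
open import Data.List using (List; []; _∷_; length; filter; allFin; applyUpTo)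
import Data.List as List
open import Data.List.Properties using (length-applyUpTo; length-tabulate)
open import Data.List.Relation.Unary.Any using (here; there; any?)
open import Data.List.Relation.Unary.All as All using ()
open import Data.List.Relation.Unary.AllPairs using ([]; _∷_)
open import Data.List.Relation.Unary.Unique.Propositional using (Unique)
open import Data.List.Relation.Unary.Unique.Propositional.Properties
  using (applyUpTo⁺₁; allFin⁺; filter⁺)
open import Data.List.Membership.Propositional using (_∈_)
open import Data.List.Membership.Propositional.Properties
  using (∈-applyUpTo⁺; ∈-applyUpTo⁻; ∈-filter⁺; ∈-filter⁻; ∈-allFin)
open import Data.List.Relation.Binary.Subset.Propositional using (_⊆_)
open import Data.Maybe using (Maybe; just; nothing; is-just; maybe)
open import Data.Bool using (Bool; true; false; T; if_then_else_)
open import Data.Product using (Σ; _×_; _,_; proj₂; ∃; ∃-syntax)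
open import Data.Product.Function.NonDependent.Propositional using (_×-⇔_)
open import Data.Sum using (inj₁; inj₂)
open import Data.Sum.Function.Propositional using (_⊎-⇔_)
open import Data.Unit using (tt)
open import Data.Empty using (⊥-elim)
open import Function using (_∘_)
open import Function.Bundles using (mk⇔; Equivalence)
open import Function.Construct.Composition using (_⇔-∘_)
open import Function.Construct.Symmetry using (⇔-sym)
open import Function.Construct.Identity using (⇔-id)
open import Function.Related.TypeIsomorphisms using (→-cong-⇔; ¬-cong-⇔)
open import Relation.Nullary using (¬_; ¬?; does)
open import Relation.Unary using (Decidable)
open import Relation.Nullary.Decidable using (T?; decidable-stable)
open import Relation.Binary.PropositionalEquality
  using (_≡_; _≢_; refl; sym; trans; cong; cong₂; subst; module ≡-Reasoning)

-- An SL-structure (Fin m, s, h) and a first-order structure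
-- (Fin m, s, 𝔡, 𝔣₁, …, 𝔣ₖ) describe the same data when h(u) is defined
-- exactly for the cells u with 𝔡(u), and then equals (𝔣₁(u), …, 𝔣ₖ(u));
-- we then say that (𝔡, 𝔣) encodes h.  Every heap is encoded by some
-- interpretation and every interpretation encodes a heap, over the same
-- finite universe and store, so the theorem follows from the translation
-- lemma: in an encoded structure φ and T(φ) are equivalent under every
-- store.  It is proved by induction on φ; the only real work lies in the
-- cardinality atoms |h| ≥ n, |U| ≥ n and |h| ≥ |U| - n, which we reduce to
-- counting duplicate-free lists of cells (all cells, those inside 𝔡, those
-- outside 𝔡).  Such counts are bounded from above by the pigeonhole
-- principle for lists and from below by enumerating the list.

open Equivalence using (to; from)

module DuplicateFreeLists {A : Set} where

  delete : ∀ {x} (ys : List A) → x ∈ ys →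
           Σ (List A) λ zs → length ys ≡ suc (length zs) × (∀ {y} → y ∈ ys → y ≢ x → y ∈ zs)
  delete (y ∷ ys) (here refl) = ys , refl , λ where
    (here refl) y≢y → ⊥-elim (y≢y refl)
    (there y∈ys) _  → y∈ys
  delete (y ∷ ys) (there x∈ys) with delete ys x∈ys
  ... | zs , len , keep = y ∷ zs , cong suc len , λ where
    (here refl) _   → here refl
    (there z∈ys) z≢x → there (keep z∈ys z≢x)

  unique-⊆⇒≤ : ∀ {xs ys : List A} → Unique xs → xs ⊆ ys → length xs ≤ length ys
  unique-⊆⇒≤ {[]}     _            _     = z≤n
  unique-⊆⇒≤ {x ∷ xs} {ys} (x∉xs ∷ u) xs⊆ys with delete ys (xs⊆ys (here refl))
  ... | zs , len , keep rewrite len =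
    s≤s (unique-⊆⇒≤ u λ y∈xs → keep (xs⊆ys (there y∈xs)) λ y≡x → All.lookup x∉xs y∈xs (sym y≡x))

  nth : A → List A → ℕ → A
  nth a []       _       = a
  nth a (x ∷ xs) zero    = x
  nth a (x ∷ xs) (suc i) = nth a xs i

  nth-∈ : ∀ a xs {i} → i < length xs → nth a xs i ∈ xs
  nth-∈ a (x ∷ xs) {zero}  _          = here refl
  nth-∈ a (x ∷ xs) {suc i} (s≤s i<n) = there (nth-∈ a xs i<n)

  ∈⇒nth : ∀ a {x} xs → x ∈ xs → ∃[ i ] (i < length xs × nth a xs i ≡ x)
  ∈⇒nth a (y ∷ ys) (here refl)  = zero , s≤s z≤n , refl
  ∈⇒nth a (y ∷ ys) (there x∈ys) with ∈⇒nth a ys x∈ys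
  ... | i , i<n , eq = suc i , s≤s i<n , eq

  nth-injective : ∀ a {xs} → Unique xs → ∀ {i j} → i < length xs → j < length xs →
                  nth a xs i ≡ nth a xs j → i ≡ j
  nth-injective a {x ∷ xs} _           {zero}  {zero}  _         _         _  = refl
  nth-injective a {x ∷ xs} (x∉xs ∷ _) {zero}  {suc j} _         (s≤s j<n) eq =
    ⊥-elim (All.lookup x∉xs (nth-∈ a xs j<n) eq)
  nth-injective a {x ∷ xs} (x∉xs ∷ _) {suc i} {zero}  (s≤s i<n) _         eq =
    ⊥-elim (All.lookup x∉xs (nth-∈ a xs i<n) (sym eq))
  nth-injective a {x ∷ xs} (_ ∷ u)    {suc i} {suc j} (s≤s i<n) (s≤s j<n) eq =
    cong suc (nth-injective a u i<n j<n eq)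

  Distinct : ℕ → (ℕ → A) → Set
  Distinct n t = ∀ {i j} → j < i → i < n → t i ≢ t j

  distinct-in⇒≤ : ∀ {L n t} → Distinct n t → (∀ {i} → i < n → t i ∈ L) → n ≤ length L
  distinct-in⇒≤ {L} {n} {t} dist t∈L =
    subst (_≤ length L) (length-applyUpTo t n)
      (unique-⊆⇒≤ (applyUpTo⁺₁ t n λ i<j j<n eq → dist i<j j<n (sym eq)) values⊆L)
    where
    values⊆L : applyUpTo t n ⊆ L
    values⊆L v∈ with ∈-applyUpTo⁻ t v∈
    ... | i , i<n , refl = t∈L i<n

  ≤⇒distinct-in : ∀ a {L n} → Unique L → n ≤ length L →
                  Distinct n (nth a L) × (∀ {i} → i < n → nth a L i ∈ L)
  ≤⇒distinct-in a {L} u n≤L =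
    (λ j<i i<n eq → <⇒≢ j<i (sym (nth-injective a u (<-≤-trans i<n n≤L)
                                   (<-≤-trans (<-trans j<i i<n) n≤L) eq))) ,
    (λ i<n → nth-∈ a L (<-≤-trans i<n n≤L))

  covered⇒≤ : ∀ {L n t} → Unique L → L ⊆ applyUpTo t n → length L ≤ n
  covered⇒≤ {n = n} {t} u L⊆t = subst (_ ≤_) (length-applyUpTo t n) (unique-⊆⇒≤ u L⊆t)

  ≤⇒covered : ∀ a {L n} → length L ≤ n → L ⊆ applyUpTo (nth a L) n
  ≤⇒covered a {L} L≤n x∈L with ∈⇒nth a L x∈L
  ... | i , i<L , refl = ∈-applyUpTo⁺ (nth a L) (<-≤-trans i<L L≤n)

  length-filter-split : ∀ {P : A → Set} (P? : Decidable P) xs →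
                        length (filter P? xs) + length (filter (¬? ∘ P?) xs) ≡ length xs
  length-filter-split P? [] = refl
  length-filter-split P? (x ∷ xs) with does (P? x)
  ... | true  = cong suc (length-filter-split P? xs)
  ... | false = trans (+-suc _ _) (cong suc (length-filter-split P? xs))

open DuplicateFreeLists

module Cells {m : ℕ} (p : Fin m → Bool) where

  inside outside : List (Fin m)
  inside  = filter (T? ∘ p) (allFin m)
  outside = filter (¬? ∘ T? ∘ p) (allFin m)

  inside-unique : Unique inside
  inside-unique = filter⁺ (T? ∘ p) (allFin⁺ m)

  outside-unique : Unique outside
  outside-unique = filter⁺ (¬? ∘ T? ∘ p) (allFin⁺ m)

  ∈-inside⁺ : ∀ {u} → T (p u) → u ∈ inside
  ∈-inside⁺ {u} = ∈-filter⁺ (T? ∘ p) (∈-allFin u)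

  ∈-inside⁻ : ∀ {u} → u ∈ inside → T (p u)
  ∈-inside⁻ = proj₂ ∘ ∈-filter⁻ (T? ∘ p) {xs = allFin m}

  ∈-outside⁺ : ∀ {u} → ¬ T (p u) → u ∈ outside
  ∈-outside⁺ {u} = ∈-filter⁺ (¬? ∘ T? ∘ p) (∈-allFin u)

  ∈-outside⁻ : ∀ {u} → u ∈ outside → ¬ T (p u)
  ∈-outside⁻ = proj₂ ∘ ∈-filter⁻ (¬? ∘ T? ∘ p) {xs = allFin m}

  card : ℕ
  card = length inside

  length-outside : length outside ≡ m ∸ card
  length-outside = begin
    length outside                   ≡⟨ sym (m+n∸m≡n card _) ⟩
    card + length outside ∸ card     ≡⟨ cong (_∸ card) (length-filter-split (T? ∘ p) (allFin m)) ⟩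
    length (allFin m) ∸ card         ≡⟨ cong (_∸ card) (length-tabulate (λ u → u)) ⟩
    m ∸ card                         ∎
    where open ≡-Reasoning

open Cells using (card)

-- domSize h counts the cells where h is defined, among the cells listed by
-- tabulate g; it is stated for arbitrary g so that the induction on m goes
-- through.
domSize-filter : ∀ {B : Set} {m M} (h : Fin m → Maybe B) (g : Fin m → Fin M) (p : Fin M → Bool) →
                 (∀ u → is-just (h u) ≡ p (g u)) →
                 domSize h ≡ length (filter (T? ∘ p) (List.tabulate g))
domSize-filter {m = zero}  h g p agree = refl
domSize-filter {m = suc m} h g p agree with h zero | p (g zero) | agree zero
... | just _  | .true  | refl = cong suc (domSize-filter (h ∘ suc) (g ∘ suc) p (agree ∘ suc))
... | nothing | .false | refl = domSize-filter (h ∘ suc) (g ∘ suc) p (agree ∘ suc)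

domSize≡card : ∀ {B : Set} {m} (h : Fin m → Maybe B) (p : Fin m → Bool) →
               (∀ u → is-just (h u) ≡ p u) → domSize h ≡ card p
domSize≡card h p = domSize-filter h (λ u → u) p

module FirstOrder {k m : ℕ} (d : Fin m → Bool) (f : Fin k → Fin m → Fin m) where

  ⋀-intro : ∀ n F s → (∀ {i} → i < n → ⟦ F i ⟧ᶠ d f s) → ⟦ ⋀ n F ⟧ᶠ d f s
  ⋀-intro zero    F s _     = tt
  ⋀-intro (suc n) F s holds = ⋀-intro n F s (holds ∘ m<n⇒m<1+n) , holds (n<1+n n)

  ⋀-elim : ∀ n F s → ⟦ ⋀ n F ⟧ᶠ d f s → ∀ {i} → i < n → ⟦ F i ⟧ᶠ d f s
  ⋀-elim (suc n) F s (rest , last) i<1+n with m<1+n⇒m<n∨m≡n i<1+n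
  ... | inj₁ i<n  = ⋀-elim n F s rest i<n
  ... | inj₂ refl = last

  -- The store reached after n nested ∃ᶠ choosing t (n-1), …, t 0.
  ext : ℕ → (ℕ → Fin m) → Store m → Store m
  ext zero    t s = s
  ext (suc n) t s = ext n t (t n ∷ₛ s)

  ext-above : ∀ n t s x → ext n t s (n + x) ≡ s x
  ext-above zero    t s x = refl
  ext-above (suc n) t s x =
    trans (cong (ext n t (t n ∷ₛ s)) (sym (+-suc n x))) (ext-above n t (t n ∷ₛ s) (suc x))

  ext-below : ∀ n t s {i} → i < n → ext n t s i ≡ t i
  ext-below (suc n) t s i<1+n with m<1+n⇒m<n∨m≡n i<1+n
  ... | inj₁ i<n  = ext-below n t (t n ∷ₛ s) i<n
  ... | inj₂ refl = trans (cong (ext n t (t n ∷ₛ s)) (sym (+-identityʳ n))) (ext-above n t _ 0)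

  ∃ⁿ-intro : ∀ n ψ t s → ⟦ ψ ⟧ᶠ d f (ext n t s) → ⟦ ∃ⁿ n ψ ⟧ᶠ d f s
  ∃ⁿ-intro zero    ψ t s holds = holds
  ∃ⁿ-intro (suc n) ψ t s holds = t n , ∃ⁿ-intro n ψ t (t n ∷ₛ s) holds

  ∃ⁿ-elim : ∀ n ψ s → ⟦ ∃ⁿ n ψ ⟧ᶠ d f s → ∃[ r ] ⟦ ψ ⟧ᶠ d f r
  ∃ⁿ-elim zero    ψ s holds       = s , holds
  ∃ⁿ-elim (suc n) ψ s (u , holds) = ∃ⁿ-elim n ψ (u ∷ₛ s) holds

  distinct-intro : ∀ n r → Distinct n r → ⟦ distinct n ⟧ᶠ d f r
  distinct-intro n r dist = ⋀-intro n _ r λ i<n → ⋀-intro _ _ r λ j<i → dist j<i i<n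

  distinct-elim : ∀ n r → ⟦ distinct n ⟧ᶠ d f r → Distinct n r
  distinct-elim n r holds j<i i<n = ⋀-elim _ _ r (⋀-elim n _ r holds i<n) j<i

  ext-distinct : ∀ n t s → Distinct n t → Distinct n (ext n t s)
  ext-distinct n t s dist j<i i<n eq =
    dist j<i i<n (trans (sym (ext-below n t s i<n)) (trans eq (ext-below n t s (<-trans j<i i<n))))

  ext-∈ : ∀ n t s {L} → (∀ {i} → i < n → t i ∈ L) → ∀ {i} → i < n → ext n t s i ∈ L
  ext-∈ n t s t∈L i<n = subst (_∈ _) (sym (ext-below n t s i<n)) (t∈L i<n)

  open Cells d hiding (card)

  -- |U| ≥ n: the universe has n distinct elements.  In the witnessing
  -- directions below, the store value s 0 serves as a default cell.
  |U|≥-correct : ∀ n s → (n ≤ m) ⇔ ⟦ Tr {k} (|U|≥ n) ⟧ᶠ d f s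
  |U|≥-correct n s = mk⇔ enough-cells distinct-cells
    where
    length-allFin : length (allFin m) ≡ m
    length-allFin = length-tabulate (λ u → u)

    enough-cells : n ≤ m → ⟦ Tr {k} (|U|≥ n) ⟧ᶠ d f s
    enough-cells n≤m =
      let dist , _ = ≤⇒distinct-in (s 0) (allFin⁺ m) (subst (n ≤_) (sym length-allFin) n≤m)
      in ∃ⁿ-intro n _ _ s (distinct-intro n _ (ext-distinct n _ s dist))

    distinct-cells : ⟦ Tr {k} (|U|≥ n) ⟧ᶠ d f s → n ≤ m
    distinct-cells holds =
      let r , dist = ∃ⁿ-elim n _ s holds
      in subst (n ≤_) length-allFin (distinct-in⇒≤ (distinct-elim n r dist) (λ _ → ∈-allFin _))

  |h|≥-correct : ∀ n s → (n ≤ card d) ⇔ ⟦ Tr {k} (|h|≥ n) ⟧ᶠ d f s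
  |h|≥-correct n s = mk⇔ enough-cells distinct-cells
    where
    enough-cells : n ≤ card d → ⟦ Tr {k} (|h|≥ n) ⟧ᶠ d f s
    enough-cells n≤card =
      let dist , t∈inside = ≤⇒distinct-in (s 0) inside-unique n≤card
      in ∃ⁿ-intro n _ _ s
           ( distinct-intro n _ (ext-distinct n _ s dist)
           , ⋀-intro n _ _ (∈-inside⁻ ∘ ext-∈ n _ s t∈inside))

    distinct-cells : ⟦ Tr {k} (|h|≥ n) ⟧ᶠ d f s → n ≤ card d
    distinct-cells holds =
      let r , dist , in-d = ∃ⁿ-elim n _ s holds
      in distinct-in⇒≤ (distinct-elim n r dist) (∈-inside⁺ ∘ ⋀-elim n _ r in-d)

  outside-among : ℕ → FOForm k
  outside-among n = ∀ᶠ (⋀ n (λ i → ¬ᶠ (var 0 ≈ᶠ var (suc i))) ⇒ᶠ 𝔡 (var 0))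

  -- Both directions use decidability (of 𝔡, resp. of list membership) to
  -- turn the negative premise of the formula into a covering statement.
  outside-among-intro : ∀ n t r → (∀ {i} → i < n → r i ≡ t i) →
                        outside ⊆ applyUpTo t n → ⟦ outside-among n ⟧ᶠ d f r
  outside-among-intro n t r r≡t covered u avoids-r =
    decidable-stable (T? (d u)) λ u∉d →
      let i , i<n , u≡ti = ∈-applyUpTo⁻ t (covered (∈-outside⁺ u∉d))
      in ⋀-elim n _ (u ∷ₛ r) avoids-r i<n (trans u≡ti (sym (r≡t i<n)))

  outside-among-elim : ∀ n r → ⟦ outside-among n ⟧ᶠ d f r → outside ⊆ applyUpTo r n
  outside-among-elim n r holds {u} u∈outside =
    decidable-stable (any? (u ≟ᶠ_) (applyUpTo r n)) λ u∉r →
      ∈-outside⁻ u∈outside (holds u (⋀-intro n _ (u ∷ₛ r) λ i<n u≡ri →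
        u∉r (subst (_∈ applyUpTo r n) (sym u≡ri) (∈-applyUpTo⁺ r i<n))))

  |h|≥|U|-correct : ∀ n s → (m ∸ card d ≤ n) ⇔ ⟦ Tr {k} (|h|≥|U|- n) ⟧ᶠ d f s
  |h|≥|U|-correct n s = mk⇔ few-outside outside-covered
    where
    few-outside : m ∸ card d ≤ n → ⟦ Tr {k} (|h|≥|U|- n) ⟧ᶠ d f s
    few-outside few =
      ∃ⁿ-intro n _ t s (outside-among-intro n t _ (ext-below n t s)
                         (≤⇒covered (s 0) (subst (_≤ n) (sym length-outside) few)))
      where t = nth (s 0) outside

    outside-covered : ⟦ Tr {k} (|h|≥|U|- n) ⟧ᶠ d f s → m ∸ card d ≤ n
    outside-covered holds =
      let r , among = ∃ⁿ-elim n _ s holds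
      in subst (_≤ n) length-outside (covered⇒≤ outside-unique (outside-among-elim n r among))

open FirstOrder

⇔-cong-⇔ : ∀ {A B C D : Set} → A ⇔ B → C ⇔ D → (A ⇔ C) ⇔ (B ⇔ D)
⇔-cong-⇔ A⇔B C⇔D = mk⇔ (λ A⇔C → C⇔D ⇔-∘ (A⇔C ⇔-∘ ⇔-sym A⇔B))
                      (λ B⇔D → ⇔-sym C⇔D ⇔-∘ (B⇔D ⇔-∘ A⇔B))

∃-cong-⇔ : ∀ {U : Set} {P Q : U → Set} → (∀ u → P u ⇔ Q u) → ∃ P ⇔ ∃ Q
∃-cong-⇔ P⇔Q = mk⇔ (λ (u , p) → u , to (P⇔Q u) p) (λ (u , q) → u , from (P⇔Q u) q)

∀-cong-⇔ : ∀ {U : Set} {P Q : U → Set} → (∀ u → P u ⇔ Q u) → (∀ u → P u) ⇔ (∀ u → Q u)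
∀-cong-⇔ P⇔Q = mk⇔ (λ p u → to (P⇔Q u) (p u)) (λ q u → from (P⇔Q u) (q u))

cell : ∀ {A : Set} → Bool → A → Maybe A
cell b v = if b then just v else nothing

is-just-cell : ∀ {A : Set} b (v : A) → is-just (cell b v) ≡ b
is-just-cell true  v = refl
is-just-cell false v = refl

cell≡just : ∀ {A : Set} b (v w : A) → (cell b v ≡ just w) ⇔ (T b × w ≡ v)
cell≡just true  v w = mk⇔ (λ where refl → tt , refl) (λ where (_ , refl) → refl)
cell≡just false v w = mk⇔ (λ ()) (λ ())

cell-allocated : ∀ {A : Set} b (v : A) → (∃[ w ] cell b v ≡ just w) ⇔ T b
cell-allocated true  v = mk⇔ (λ _ → tt) (λ _ → v , refl)
cell-allocated false v = mk⇔ (λ ()) (λ ())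

heapOf : ∀ {k m} → (Fin m → Bool) → (Fin k → Fin m → Fin m) → Fin m → Maybe (Vec (Fin m) k)
heapOf d f u = cell (d u) (tabulate λ i → f i u)

Encodes : ∀ {k m} → (Fin m → Maybe (Vec (Fin m) k)) → (Fin m → Bool) → (Fin k → Fin m → Fin m) → Set
Encodes h d f = ∀ u → h u ≡ heapOf d f u

-- Every heap is encoded by some interpretation (unallocated cells are
-- sent to themselves by the 𝔣ᵢ) …
interpretation : ∀ {k m} → (Fin m → Maybe (Vec (Fin m) k)) → (Fin m → Bool) × (Fin k → Fin m → Fin m)
interpretation h = (λ u → is-just (h u)) , (λ i u → maybe (λ v → lookup v i) u (h u))

interpretation-encodes : ∀ {k m} (h : Fin m → Maybe (Vec (Fin m) k)) →
                         let d , f = interpretation h in Encodes h d f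
interpretation-encodes h u with h u
... | just v  = cong just (sym (tabulate∘lookup v))
... | nothing = refl

domSize-encoded : ∀ {k m} {h : Fin m → Maybe (Vec (Fin m) k)} {d f} → Encodes h d f → domSize h ≡ card d
domSize-encoded {h = h} {d} {f} enc =
  domSize≡card h d λ u → trans (cong is-just (enc u)) (is-just-cell (d u) _)

tuple-correct : ∀ {k m j} d f (s : Store m) x (g : Fin j → Fin k) (ys : Vec Var j) →
                ⟦ ⋀ᶠ j (λ i → var (lookup ys i) ≈ᶠ 𝔣 (g i) (var x)) ⟧ᶠ d f s
                  ⇔ (Vec.map s ys ≡ tabulate (λ i → f (g i) (s x)))
tuple-correct d f s x g []       = mk⇔ (λ _ → refl) (λ _ → tt)
tuple-correct d f s x g (y ∷ ys) = mk⇔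
  (λ (head , tail) → cong₂ _∷_ head (to rest tail))
  (λ eq → let head , tail = ∷-injective eq in head , from rest tail)
  where rest = tuple-correct d f s x (g ∘ suc) ys

module _ {k m} {h : Fin m → Maybe (Vec (Fin m) k)} {d f} (enc : Encodes h d f) where

  points-to-correct : ∀ x ys s → ⟦ x ↪ ys ⟧ˢ s h ⇔ ⟦ Tr (x ↪ ys) ⟧ᶠ d f s
  points-to-correct x ys s rewrite enc (s x) =
    (⇔-id _ ×-⇔ ⇔-sym (tuple-correct d f s x (λ i → i) ys)) ⇔-∘ cell≡just (d (s x)) _ (Vec.map s ys)

  alloc-correct : ∀ x s → ⟦ alloc x ⟧ˢ s h ⇔ ⟦ Tr {k} (alloc x) ⟧ᶠ d f s
  alloc-correct x s rewrite enc (s x) = cell-allocated (d (s x)) _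

  translation-correct : ∀ φ s → ⟦ φ ⟧ˢ s h ⇔ ⟦ Tr φ ⟧ᶠ d f s
  translation-correct (x ≈ˢ y)      s = ⇔-id _
  translation-correct (x ↪ ys)      s = points-to-correct x ys s
  translation-correct (alloc x)     s = alloc-correct x s
  translation-correct (|h|≥ n)      s rewrite domSize-encoded enc = |h|≥-correct d f n s
  translation-correct (|U|≥ n)      s = |U|≥-correct d f n s
  translation-correct (|h|≥|U|- n)  s rewrite domSize-encoded enc = |h|≥|U|-correct d f n s
  translation-correct (¬ˢ φ)        s = ¬-cong-⇔ (translation-correct φ s)
  translation-correct (φ ∧ˢ ψ)      s = translation-correct φ s ×-⇔ translation-correct ψ s
  translation-correct (φ ∨ˢ ψ)      s = translation-correct φ s ⊎-⇔ translation-correct ψ s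
  translation-correct (φ ⇒ˢ ψ)      s = →-cong-⇔ (translation-correct φ s) (translation-correct ψ s)
  translation-correct (φ ⇔ˢ ψ)      s = ⇔-cong-⇔ (translation-correct φ s) (translation-correct ψ s)
  translation-correct (∃ˢ φ)        s = ∃-cong-⇔ λ u → translation-correct φ (u ∷ₛ s)
  translation-correct (∀ˢ φ)        s = ∀-cong-⇔ λ u → translation-correct φ (u ∷ₛ s)

proposition2 : (k : ℕ) → 1 ≤ k → (φ : SLForm k) →
                 HasFiniteSLModel φ ⇔ HasFiniteFOModel (Tr φ)
proposition2 k _ φ = mk⇔ encode decode
  where
  encode : HasFiniteSLModel φ → HasFiniteFOModel (Tr φ)
  encode (m , M , M⊨φ) =
    let open SLStruct M; d , f = interpretation heap
    in m , record { store = store ; dI = d ; fI = f }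
         , to (translation-correct (interpretation-encodes heap) φ store) M⊨φ

  decode : HasFiniteFOModel (Tr φ) → HasFiniteSLModel φ
  decode (m , M , M⊨Tφ) =
    let open FOStruct M
    in m , record { store = store ; heap = heapOf dI fI }
         , from (translation-correct {h = heapOf dI fI} (λ _ → refl) φ store) M⊨Tφ
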